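{- Let $R$ be the set of ordered pairs $(\lambda,\mu)$ where $\lambda=(n,n-1,\ldots,1)$ for some integer $n\ge 0$ (so $\lambda$ may be empty) and $\mu=(\mu_1\ge\mu_2\ge\cdots\ge\mu_{\ell(\mu)}\ge0)$ is a finite weakly decreasing (possibly empty) sequence of nonnegative integers. Let $A_1$ be the set of ordered pairs $(X,Y)$ where $X$ is a finite (possibly empty) strictly decreasing sequence of positive integers, $Y$ is a finite (possibly empty) weakly decreasing sequence of nonnegative integers, and every entry of $Y$ is strictly smaller than every entry of $X$. Let $A_2$ be the set of ordered pairs $(X,Y)$ where $X$ is a finite (possibly empty) strictly decreasing sequence of positive integers, $Y=(m,m-1,\ldots,1)$ for some integer $m\ge1$, and every entry of $Y$ is strictly smaller than every entry of $X$. Let $A=A_1\sqcup A_2$ (disjoint union). Define $\phi$ on $R$ as follows. For $(\lambda,\mu)\in R$, let $k=\min(\ell(\lambda),\ell(\mu))$, $p=\max(\ell(\lambda),\ell(\mu))$, and let $\lambda+\mu=(s_1,\ldots,s_p)$ be the componentwise sum, where the shorter sequence is padded with zeros to length $p$. Set $X=(s_1,\ldots,s_k)$ and $Y=(s_{k+1},\ldots,s_p)$, and let $\phi((\lambda,\mu))=(X,Y)$, regarded as an element of $A_1$ if $\ell(\lambda)\le\ell(\mu)$ and as an element of $A_2$ if $\ell(\lambda)>\ell(\mu)$. Then $\phi$ is a well-defined bijection from $R$ onto $A$, and whenever $\phi((\lambda,\mu))=(X,Y)$: (1) $|\lambda|+|\mu|=|X|+|Y|$; (2) if $(X,Y)\in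 A_1$, then $\ell(X)+\ell(Y)=\ell(\mu)$ and $\ell(X)=\ell(\lambda)$; (3) if $(X,Y)\in A_2$, then $\ell(X)+\ell(Y)=\ell(\lambda)$ and $\ell(X)=\ell(\mu)$.
   Context: For a finite sequence $P$ of nonnegative integers, $\ell(P)$ is its number of entries (entries equal to $0$ are counted) and $|P|$ is the sum of its entries. The empty sequence has length $0$ and sum $0$; the condition "every entry of $Y$ is smaller than every entry of $X$" holds vacuously if $X$ or $Y$ is empty. -}

module Defs where

open import Data.Nat using (ℕ; zero; suc; _+_; _≤_; _<_; _≥_; _>_; _⊓_; _≤?_)
open import Data.List using (List; []; _∷_; length; take; drop)
open import Data.List.Relation.Unary.All using (All)
open import Data.List.Relation.Unary.Linked using (Linked)
open import Data.Product using (Σ; ∃; _×_; _,_)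
open import Data.Sum using (_⊎_; inj₁; inj₂)
open import Relation.Binary.PropositionalEquality using (_≡_)
open import Relation.Nullary using (yes; no)

staircase : ℕ → List ℕ
staircase zero    = []
staircase (suc n) = suc n ∷ staircase n

IsStaircase : List ℕ → Set
IsStaircase l = ∃ λ n → l ≡ staircase n

WeaklyDecr : List ℕ → Set
WeaklyDecr = Linked _≥_

StrictDecrPos : List ℕ → Set
StrictDecrPos X = Linked _>_ X × All (λ x → 0 < x) X

AllBelow : List ℕ → List ℕ → Set
AllBelow Y X = All (λ y → All (λ x → y < x) X) Y

InR : List ℕ → List ℕ → Set
InR lam mu = IsStaircase lam × WeaklyDecr mu

InA₁ : List ℕ → List ℕ → Set
InA₁ X Y = StrictDecrPos X × WeaklyDecr Y × AllBelow Y X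

InA₂ : List ℕ → List ℕ → Set
InA₂ X Y = StrictDecrPos X × (∃ λ m → 1 ≤ m × Y ≡ staircase m) × AllBelow Y X

RawA : Set
RawA = (List ℕ × List ℕ) ⊎ (List ℕ × List ℕ)

InA : RawA → Set
InA (inj₁ (X , Y)) = InA₁ X Y
InA (inj₂ (X , Y)) = InA₂ X Y

padSum : List ℕ → List ℕ → List ℕ
padSum []       ys       = ys
padSum (x ∷ xs) []       = x ∷ xs
padSum (x ∷ xs) (y ∷ ys) = (x + y) ∷ padSum xs ys

phi : List ℕ → List ℕ → RawA
phi lam mu with length lam ≤? length mu
... | yes _ = inj₁ (take k s , drop k s)
  where k = length lam ⊓ length mu
        s = padSum lam mu
... | no _  = inj₂ (take k s , drop k s)
  where k = length lam ⊓ length mu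
        s = padSum lam mu

module Submission where

-- For λ = staircase n everything is governed by two explicit recursions on μ:
-- stairHead n μ = (n + μ₁, n-1 + μ₂, …) of length n ⊓ ℓ(μ), and stairTail n μ,
-- the rest of λ + μ (the leftover part of μ, or of the staircase).
-- Injectivity: n is recovered from the lengths of X and Y, and then μ from
-- (X, Y).  Surjectivity: `unstair c X` subtracts from X the staircase
-- (ℓ(X) + c, …, c + 1); the preimage of (X, Y) ∈ A₁ is
-- (staircase ℓ(X), unstair 0 X ++ Y), and that of (X, staircase m) ∈ A₂ is
-- (staircase (ℓ(X) + m), unstair m X).

open import Defs
open import Data.Nat using (ℕ; zero; suc; _+_; _∸_; _≤_; _<_; _>_; _⊓_; _⊔_; _≤?_; z≤n; s≤s)
open import Data.Nat.Properties
open import Data.Nat.ListAction using (sum)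
open import Data.List using (List; []; _∷_; _++_; length; take; drop)
open import Data.List.Properties using (∷-injective)
open import Data.List.Relation.Unary.All as All using (All; []; _∷_)
open import Data.List.Relation.Unary.Linked as Linked using (Linked; []; [-]; _∷_)
open import Data.List.Relation.Unary.Linked.Properties using (Linked⇒All)
open import Data.Product using (∃; _×_; _,_; proj₁; proj₂)
open import Data.Product.Properties using (,-injective)
open import Data.Sum using (_⊎_; inj₁; inj₂)
open import Data.Sum.Properties using (inj₁-injective; inj₂-injective)
open import Data.Empty using (⊥-elim)
open import Relation.Nullary using (yes; no)
open import Relation.Binary.PropositionalEquality
  using (_≡_; _≢_; refl; sym; trans; cong; cong₂; subst; module ≡-Reasoning)
open import Algebra.Properties.CommutativeSemigroup +-commutativeSemigroup using (interchange)

length-staircase : ∀ n → length (staircase n) ≡ n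
length-staircase zero    = refl
length-staircase (suc n) = cong suc (length-staircase n)

staircase-weaklyDecr : ∀ n → WeaklyDecr (staircase n)
staircase-weaklyDecr zero          = []
staircase-weaklyDecr (suc zero)    = [-]
staircase-weaklyDecr (suc (suc n)) = n≤1+n (suc n) ∷ staircase-weaklyDecr (suc n)

staircase-bounded : ∀ {n c} → n ≤ c → All (_≤ c) (staircase n)
staircase-bounded {zero}  _   = []
staircase-bounded {suc n} n≤c = n≤c ∷ staircase-bounded (≤-trans (n≤1+n n) n≤c)

weaklyDecr-head : ∀ {y ys} → WeaklyDecr (y ∷ ys) → All (_≤ y) ys
weaklyDecr-head w = All.tail (Linked⇒All (λ p q → ≤-trans q p) ≤-refl w)

stairHead : ℕ → List ℕ → List ℕ
stairHead zero    _        = []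
stairHead (suc n) []       = []
stairHead (suc n) (y ∷ ys) = suc n + y ∷ stairHead n ys

stairTail : ℕ → List ℕ → List ℕ
stairTail zero    ys       = ys
stairTail (suc n) []       = staircase (suc n)
stairTail (suc n) (y ∷ ys) = stairTail n ys

take-padSum-staircase : ∀ n μ →
  take (length (staircase n) ⊓ length μ) (padSum (staircase n) μ) ≡ stairHead n μ
take-padSum-staircase zero    μ        = refl
take-padSum-staircase (suc n) []       = refl
take-padSum-staircase (suc n) (y ∷ ys) = cong (suc n + y ∷_) (take-padSum-staircase n ys)

drop-padSum-staircase : ∀ n μ →
  drop (length (staircase n) ⊓ length μ) (padSum (staircase n) μ) ≡ stairTail n μ
drop-padSum-staircase zero    μ        = refl
drop-padSum-staircase (suc n) []       = refl
drop-padSum-staircase (suc n) (y ∷ ys) = drop-padSum-staircase n ys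

phi-staircase-A₁ : ∀ {n μ} → n ≤ length μ →
  phi (staircase n) μ ≡ inj₁ (stairHead n μ , stairTail n μ)
phi-staircase-A₁ {n} {μ} n≤ℓμ with length (staircase n) ≤? length μ
... | yes _ = cong₂ (λ X Y → inj₁ (X , Y)) (take-padSum-staircase n μ) (drop-padSum-staircase n μ)
... | no ℓλ≰ℓμ = ⊥-elim (ℓλ≰ℓμ (subst (_≤ length μ) (sym (length-staircase n)) n≤ℓμ))

phi-staircase-A₂ : ∀ {n μ} → length μ < n →
  phi (staircase n) μ ≡ inj₂ (stairHead n μ , stairTail n μ)
phi-staircase-A₂ {n} {μ} ℓμ<n with length (staircase n) ≤? length μ
... | yes ℓλ≤ℓμ = ⊥-elim (<⇒≱ ℓμ<n (subst (_≤ length μ) (length-staircase n) ℓλ≤ℓμ))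
... | no _ = cong₂ (λ X Y → inj₂ (X , Y)) (take-padSum-staircase n μ) (drop-padSum-staircase n μ)

phi-staircase : ∀ n μ →
  (n ≤ length μ × phi (staircase n) μ ≡ inj₁ (stairHead n μ , stairTail n μ)) ⊎
  (length μ < n × phi (staircase n) μ ≡ inj₂ (stairHead n μ , stairTail n μ))
phi-staircase n μ with ≤-<-connex n (length μ)
... | inj₁ n≤ℓμ = inj₁ (n≤ℓμ , phi-staircase-A₁ n≤ℓμ)
... | inj₂ ℓμ<n = inj₂ (ℓμ<n , phi-staircase-A₂ ℓμ<n)

summands-disjoint : ∀ {a b : List ℕ × List ℕ} → _≢_ {A = RawA} (inj₁ a) (inj₂ b)
summands-disjoint ()

-- If μ is weakly decreasing, the head is strictly decreasing and positive,
-- since the staircase entries drop by exactly one at each step.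
stairHead-strictDecrPos : ∀ n {μ} → WeaklyDecr μ → StrictDecrPos (stairHead n μ)
stairHead-strictDecrPos n μ↓ = decreasing n μ↓ , positive n _
  where
  decreasing : ∀ n {μ} → WeaklyDecr μ → Linked _>_ (stairHead n μ)
  decreasing zero          _                         = []
  decreasing (suc n)       {[]}        _             = []
  decreasing (suc zero)    {_ ∷ _}     _             = [-]
  decreasing (suc (suc n)) {_ ∷ []}    _             = [-]
  decreasing (suc (suc n)) {_ ∷ _ ∷ _} (y≥y′ ∷ μ↓) =
    s≤s (s≤s (+-monoʳ-≤ n y≥y′)) ∷ decreasing (suc n) μ↓

  positive : ∀ n μ → All (0 <_) (stairHead n μ)
  positive zero    _        = []
  positive (suc n) []       = []
  positive (suc n) (_ ∷ ys) = s≤s z≤n ∷ positive n ys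

stairTail-weaklyDecr : ∀ n {μ} → WeaklyDecr μ → WeaklyDecr (stairTail n μ)
stairTail-weaklyDecr zero            μ↓ = μ↓
stairTail-weaklyDecr (suc n) {[]}    _  = staircase-weaklyDecr (suc n)
stairTail-weaklyDecr (suc n) {_ ∷ _} μ↓ = stairTail-weaklyDecr n (Linked.tail μ↓)

stairTail-bounded : ∀ n {μ c} → All (_≤ c) μ → n ≤ c → All (_≤ c) (stairTail n μ)
stairTail-bounded zero            μ≤c       _   = μ≤c
stairTail-bounded (suc n) {[]}    _         n≤c = staircase-bounded n≤c
stairTail-bounded (suc n) {_ ∷ _} (_ ∷ μ≤c) n≤c = stairTail-bounded n μ≤c (≤-trans (n≤1+n n) n≤c)

-- Every entry of the tail is below every entry of the head: the tail is
-- bounded by n + y, where y is the first entry of μ used in the head.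
stairTail-below : ∀ n {μ} → WeaklyDecr μ → AllBelow (stairTail n μ) (stairHead n μ)
stairTail-below zero    {μ}      _  = All.universal (λ _ → []) μ
stairTail-below (suc n) {[]}     _  = All.universal (λ _ → []) (staircase (suc n))
stairTail-below (suc n) {y ∷ ys} μ↓ =
  All.zipWith (λ (p , q) → p ∷ q) (below-first , stairTail-below n (Linked.tail μ↓))
  where
  below-first : All (_< suc n + y) (stairTail n ys)
  below-first = All.map s≤s (stairTail-bounded n
    (All.map (λ y′≤y → ≤-trans y′≤y (m≤n+m y n)) (weaklyDecr-head μ↓)) (m≤m+n n y))

stairTail-staircase : ∀ n μ → length μ < n → ∃ λ m → 1 ≤ m × stairTail n μ ≡ staircase m
stairTail-staircase (suc n) []       _            = suc n , s≤s z≤n , refl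
stairTail-staircase (suc n) (_ ∷ ys) (s≤s ℓys<n) = stairTail-staircase n ys ℓys<n

sum-stair : ∀ n μ → sum (staircase n) + sum μ ≡ sum (stairHead n μ) + sum (stairTail n μ)
sum-stair zero    μ        = refl
sum-stair (suc n) []       = +-identityʳ _
sum-stair (suc n) (y ∷ ys) = begin
  (suc n + sum (staircase n)) + (y + sum ys)
    ≡⟨ interchange (suc n) (sum (staircase n)) y (sum ys) ⟩
  (suc n + y) + (sum (staircase n) + sum ys)
    ≡⟨ cong (suc n + y +_) (sum-stair n ys) ⟩
  (suc n + y) + (sum (stairHead n ys) + sum (stairTail n ys))
    ≡⟨ sym (+-assoc (suc n + y) _ _) ⟩
  (suc n + y + sum (stairHead n ys)) + sum (stairTail n ys) ∎
  where open ≡-Reasoning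

length-stairHead : ∀ n μ → length (stairHead n μ) ≡ n ⊓ length μ
length-stairHead zero    _        = refl
length-stairHead (suc n) []       = refl
length-stairHead (suc n) (_ ∷ ys) = cong suc (length-stairHead n ys)

length-stairParts : ∀ n μ → length (stairHead n μ) + length (stairTail n μ) ≡ n ⊔ length μ
length-stairParts zero    _        = refl
length-stairParts (suc n) []       = length-staircase (suc n)
length-stairParts (suc n) (_ ∷ ys) = cong suc (length-stairParts n ys)

stairParts-lengths-A₁ : ∀ {n μ} → n ≤ length μ →
  length (stairHead n μ) + length (stairTail n μ) ≡ length μ × length (stairHead n μ) ≡ n
stairParts-lengths-A₁ {n} {μ} n≤ℓμ =
  trans (length-stairParts n μ) (m≤n⇒m⊔n≡n n≤ℓμ) ,
  trans (length-stairHead n μ) (m≤n⇒m⊓n≡m n≤ℓμ)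

stairParts-lengths-A₂ : ∀ {n μ} → length μ < n →
  length (stairHead n μ) + length (stairTail n μ) ≡ n × length (stairHead n μ) ≡ length μ
stairParts-lengths-A₂ {n} {μ} ℓμ<n =
  trans (length-stairParts n μ) (m≥n⇒m⊔n≡m (<⇒≤ ℓμ<n)) ,
  trans (length-stairHead n μ) (m≥n⇒m⊓n≡n (<⇒≤ ℓμ<n))

stairParts-injective : ∀ n {μ μ′} →
  stairHead n μ ≡ stairHead n μ′ → stairTail n μ ≡ stairTail n μ′ → μ ≡ μ′
stairParts-injective zero                        _ tails = tails
stairParts-injective (suc n) {[]}     {[]}       _ _     = refl
stairParts-injective (suc n) {[]}     {_ ∷ _}    () _
stairParts-injective (suc n) {_ ∷ _}  {[]}       () _
stairParts-injective (suc n) {y ∷ ys} {y′ ∷ ys′} heads tails =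
  let (first , rest) = ∷-injective heads
  in cong₂ _∷_ (+-cancelˡ-≡ (suc n) y y′ first) (stairParts-injective n rest tails)

stairParts-determine : ∀ {n n′ μ μ′} → n ≡ n′ →
  stairHead n μ ≡ stairHead n′ μ′ → stairTail n μ ≡ stairTail n′ μ′ →
  staircase n ≡ staircase n′ × μ ≡ μ′
stairParts-determine {n} refl heads tails = refl , stairParts-injective n heads tails

unstair : ℕ → List ℕ → List ℕ
unstair c []       = []
unstair c (x ∷ xs) = x ∸ (suc (length xs) + c) ∷ unstair c xs

length-unstair-++ : ∀ c X Y → length (unstair c X ++ Y) ≡ length X + length Y
length-unstair-++ c []       Y = refl
length-unstair-++ c (_ ∷ xs) Y = cong suc (length-unstair-++ c xs Y)

-- In a strictly decreasing list with entries above c, each entry exceeds c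
-- by more than the number of entries after it; so the subtraction is exact.
strictDecr-gap : ∀ c x xs → Linked _>_ (x ∷ xs) → All (c <_) (x ∷ xs) → length xs + c < x
strictDecr-gap c x []        _             (x>c ∷ _) = x>c
strictDecr-gap c x (x′ ∷ xs) (x>x′ ∷ X↓) (_ ∷ X>c) =
  ≤-trans (s≤s (strictDecr-gap c x′ xs X↓ X>c)) x>x′

-- Adding the staircase back recovers X, provided the remaining staircase
-- (c, …, 1) does not reach into Y (i.e. c = 0 or Y = []).
stairHead-unstair : ∀ c X Y → stairHead c Y ≡ [] → Linked _>_ X → All (c <_) X →
  stairHead (length X + c) (unstair c X ++ Y) ≡ X
stairHead-unstair c []       Y headY _  _   = headY
stairHead-unstair c (x ∷ xs) Y headY X↓ X>c =
  cong₂ _∷_ (m+[n∸m]≡n (strictDecr-gap c x xs X↓ X>c))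
            (stairHead-unstair c xs Y headY (Linked.tail X↓) (All.tail X>c))

stairTail-unstair : ∀ c X Y → stairTail (length X + c) (unstair c X ++ Y) ≡ stairTail c Y
stairTail-unstair c []       Y = refl
stairTail-unstair c (_ ∷ xs) Y = stairTail-unstair c xs Y

-- The recovered μ is weakly decreasing: consecutive entries of X drop by at
-- least the one unit by which the subtracted staircase drops, and at the
-- junction the last entry of X exceeds c + (first entry of Y).
unstair-weaklyDecr : ∀ c X Y → Linked _>_ X → WeaklyDecr Y →
  All (λ y → All (λ x → c + y < x) X) Y → WeaklyDecr (unstair c X ++ Y)
unstair-weaklyDecr c []             Y        _            Y↓ _ = Y↓
unstair-weaklyDecr c (x ∷ [])       []       _            _  _ = [-]
unstair-weaklyDecr c (x ∷ [])       (y ∷ ys) _            Y↓ ((c+y<x ∷ []) ∷ _) =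
  subst (_≤ x ∸ suc c) (m+n∸m≡n c y) (∸-monoˡ-≤ (suc c) c+y<x) ∷ Y↓
unstair-weaklyDecr c (x ∷ x′ ∷ xs) Y        (x>x′ ∷ X↓) Y↓ Y<X =
  ∸-monoˡ-≤ (suc (suc (length xs)) + c) x>x′ ∷
  unstair-weaklyDecr c (x′ ∷ xs) Y X↓ Y↓ (All.map All.tail Y<X)

phi-wellDefined : ∀ lam mu → InR lam mu → InA (phi lam mu)
phi-wellDefined _ μ ((n , refl) , μ↓) with phi-staircase n μ
... | inj₁ (_ , e) rewrite e =
  stairHead-strictDecrPos n μ↓ , stairTail-weaklyDecr n μ↓ , stairTail-below n μ↓
... | inj₂ (ℓμ<n , e) rewrite e =
  stairHead-strictDecrPos n μ↓ , stairTail-staircase n μ ℓμ<n , stairTail-below n μ↓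

-- The staircase size is ℓ(X) on A₁ and ℓ(X) + ℓ(Y) on A₂, and (X, Y) then
-- determines μ.
phi-injective : ∀ lam mu lam′ mu′ → InR lam mu → InR lam′ mu′ →
  phi lam mu ≡ phi lam′ mu′ → lam ≡ lam′ × mu ≡ mu′
phi-injective _ μ _ μ′ ((n , refl) , _) ((n′ , refl) , _) e
  with phi-staircase n μ | phi-staircase n′ μ′
... | inj₁ (n≤ℓμ , e₁) | inj₁ (n′≤ℓμ′ , e₁′) =
  let (heads , tails) = ,-injective (inj₁-injective (trans (sym e₁) (trans e e₁′)))
      sizes = trans (sym (proj₂ (stairParts-lengths-A₁ n≤ℓμ)))
                (trans (cong length heads) (proj₂ (stairParts-lengths-A₁ n′≤ℓμ′)))
  in stairParts-determine sizes heads tails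
... | inj₂ (ℓμ<n , e₂) | inj₂ (ℓμ′<n′ , e₂′) =
  let (heads , tails) = ,-injective (inj₂-injective (trans (sym e₂) (trans e e₂′)))
      sizes = trans (sym (proj₁ (stairParts-lengths-A₂ ℓμ<n)))
                (trans (cong₂ (λ X Y → length X + length Y) heads tails)
                  (proj₁ (stairParts-lengths-A₂ ℓμ′<n′)))
  in stairParts-determine sizes heads tails
... | inj₁ (_ , e₁) | inj₂ (_ , e₂′) = ⊥-elim (summands-disjoint (trans (sym e₁) (trans e e₂′)))
... | inj₂ (_ , e₂) | inj₁ (_ , e₁′) =
  ⊥-elim (summands-disjoint (trans (sym e₁′) (trans (sym e) e₂)))

phi-surjective : ∀ a → InA a → ∃ λ lam → ∃ λ mu → InR lam mu × phi lam mu ≡ a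
phi-surjective (inj₁ (X , Y)) ((X↓ , X>0) , Y↓ , Y<X) =
  staircase (length X + 0) , unstair 0 X ++ Y ,
  ((_ , refl) , unstair-weaklyDecr 0 X Y X↓ Y↓ Y<X) ,
  trans (phi-staircase-A₁ n≤ℓμ)
        (cong₂ (λ X Y → inj₁ (X , Y)) (stairHead-unstair 0 X Y refl X↓ X>0) (stairTail-unstair 0 X Y))
  where
  n≤ℓμ : length X + 0 ≤ length (unstair 0 X ++ Y)
  n≤ℓμ = subst (length X + 0 ≤_) (sym (length-unstair-++ 0 X Y)) (+-monoʳ-≤ (length X) z≤n)
phi-surjective (inj₂ (X , _)) (_ , (zero , () , _) , _)
phi-surjective (inj₂ (X , _)) ((X↓ , _) , (suc m , _ , refl) , (X>m ∷ _)) =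
  staircase (length X + suc m) , unstair (suc m) X ++ [] ,
  ((_ , refl) , unstair-weaklyDecr (suc m) X [] X↓ [] []) ,
  trans (phi-staircase-A₂ ℓμ<n)
        (cong₂ (λ X Y → inj₂ (X , Y)) (stairHead-unstair (suc m) X [] refl X↓ X>m)
                                      (stairTail-unstair (suc m) X []))
  where
  ℓμ<n : length (unstair (suc m) X ++ []) < length X + suc m
  ℓμ<n = subst (_< length X + suc m) (sym (length-unstair-++ (suc m) X []))
               (+-monoʳ-< (length X) (s≤s z≤n))

phi-statistics-A₁ : ∀ lam mu X Y → InR lam mu → phi lam mu ≡ inj₁ (X , Y) →
  (sum lam + sum mu ≡ sum X + sum Y) × (length X + length Y ≡ length mu) × (length X ≡ length lam)
phi-statistics-A₁ _ μ X Y ((n , refl) , _) e with phi-staircase n μ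
... | inj₂ (_ , e₂) = ⊥-elim (summands-disjoint (trans (sym e) e₂))
... | inj₁ (n≤ℓμ , e₁) with inj₁-injective (trans (sym e₁) e)
... | refl =
  sum-stair n μ , proj₁ lengths , trans (proj₂ lengths) (sym (length-staircase n))
  where lengths = stairParts-lengths-A₁ n≤ℓμ

phi-statistics-A₂ : ∀ lam mu X Y → InR lam mu → phi lam mu ≡ inj₂ (X , Y) →
  (sum lam + sum mu ≡ sum X + sum Y) × (length X + length Y ≡ length lam) × (length X ≡ length mu)
phi-statistics-A₂ _ μ X Y ((n , refl) , _) e with phi-staircase n μ
... | inj₁ (_ , e₁) = ⊥-elim (summands-disjoint (trans (sym e₁) e))
... | inj₂ (ℓμ<n , e₂) with inj₂-injective (trans (sym e₂) e)
... | refl =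
  sum-stair n μ , trans (proj₁ lengths) (sym (length-staircase n)) , proj₂ lengths
  where lengths = stairParts-lengths-A₂ ℓμ<n

mainTheorem2 :
  -- well-defined: φ maps R into A
  (∀ lam mu → InR lam mu → InA (phi lam mu))
  -- injective on R
  × (∀ lam mu lam′ mu′ → InR lam mu → InR lam′ mu′ →
       phi lam mu ≡ phi lam′ mu′ → lam ≡ lam′ × mu ≡ mu′)
  -- surjective onto A
  × (∀ a → InA a → ∃ λ lam → ∃ λ mu → InR lam mu × phi lam mu ≡ a)
  -- (1) and (2): image in A₁
  × (∀ lam mu X Y → InR lam mu → phi lam mu ≡ inj₁ (X , Y) →
       (sum lam + sum mu ≡ sum X + sum Y)
       × (length X + length Y ≡ length mu)
       × (length X ≡ length lam))
  -- (1) and (3): image in A₂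
  × (∀ lam mu X Y → InR lam mu → phi lam mu ≡ inj₂ (X , Y) →
       (sum lam + sum mu ≡ sum X + sum Y)
       × (length X + length Y ≡ length lam)
       × (length X ≡ length mu))
mainTheorem2 =
  phi-wellDefined , phi-injective , phi-surjective , phi-statistics-A₁ , phi-statistics-A₂
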